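{- Let $k\ge1$ and let $\delta=1$ if $k$ is odd, $\delta=2$ if $k$ is even. For $n\ge0$ let $T_k(n)=\sum_{m\in\mathcal{P}(n)}B(m)$. Then \[ \sum_{n\ge0}T_k(n)x^n=\left.\frac{\partial}{\partial y}F(x,y)\right|_{y=1}=\frac{x^{k+\delta}(1-x)^2}{(1-2x)^2(1-x^2)}=\frac{x^{k+\delta}(1-x)}{(1-2x)^2(1+x)}. \]
   Context: A composition of a nonnegative integer $n$ is a finite sequence $m=(m_1,\dots,m_r)$ of positive integers with $m_1+\cdots+m_r=n$; $\mathcal{P}(n)$ denotes the set of compositions of $n$, with $\mathcal{P}(0)=\{\varnothing\}$. Fix $k\ge1$, let $\mathrm{Ev}_{>k}=\{j\in\mathbb{Z}_{\ge1}: j \text{ even and } j>k\}$, for $m=(m_1,\dots,m_r)$ let $B(m)=\#\{t: m_t\in\mathrm{Ev}_{>k}\}$, and let $F(x,y)=\sum_{n\ge0}\big(\sum_{m\in\mathcal{P}(n)}y^{B(m)}\big)x^n$. Thus $T_k(n)$ is the total number of parts in $\mathrm{Ev}_{>k}$, counted with multiplicity, over all compositions of $n$. -}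

module Defs where

open import Data.Nat as ℕ using (ℕ; zero; suc; _∸_; _%_; _≡ᵇ_; _<ᵇ_)
open import Data.Integer as ℤ using (ℤ; +_; -_)
open import Data.Bool using (Bool; true; false; _∧_; if_then_else_)
open import Data.List using (List; []; _∷_; map; concatMap; upTo; length; filter; foldr)
open import Relation.Binary.PropositionalEquality using (_≡_)
open import Relation.Nullary.Decidable using (Dec; yes; no)
open import Data.Bool.Properties using () renaming (_≟_ to _≟ᵇ_)

-- Compositions of n: lists of positive integers summing to n.  The first argument is fuel (recursion depth); n suffices.

compsF : ℕ → ℕ → List (List ℕ)
compsF _        zero    = [] ∷ []
compsF zero     (suc n) = []
compsF (suc f)  (suc n) =
  concatMap (λ j → map (j ∷_) (compsF f (suc n ∸ j))) (map suc (upTo (suc n)))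

-- 𝒫(n), with 𝒫(0) = {∅}
compositions : ℕ → List (List ℕ)
compositions n = compsF n n

isEvenᵇ : ℕ → Bool
isEvenᵇ j = (j % 2) ≡ᵇ 0

inEvGt : ℕ → ℕ → Bool
inEvGt k j = isEvenᵇ j ∧ (k <ᵇ j)

B : ℕ → List ℕ → ℕ
B k m = length (filter (λ j → inEvGt k j ≟ᵇ true) m)

T : ℕ → ℕ → ℕ
T k n = foldr (λ m acc → B k m ℕ.+ acc) 0 (compositions n)

-- Polynomials (in y, over ℕ) as coefficient lists, lowest degree first.

addPℕ : List ℕ → List ℕ → List ℕ
addPℕ []       q        = q
addPℕ (a ∷ p)  []       = a ∷ p
addPℕ (a ∷ p)  (b ∷ q)  = (a ℕ.+ b) ∷ addPℕ p q

monoℕ : ℕ → List ℕ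
monoℕ zero    = 1 ∷ []
monoℕ (suc j) = 0 ∷ monoℕ j

derivAux : ℕ → List ℕ → List ℕ
derivAux i []      = []
derivAux i (a ∷ p) = (i ℕ.* a) ∷ derivAux (suc i) p

derivℕ : List ℕ → List ℕ
derivℕ []      = []
derivℕ (_ ∷ p) = derivAux 1 p

evalAt1 : List ℕ → ℕ
evalAt1 = foldr ℕ._+_ 0

-- [x^n] F(x,y) = Σ_{m ∈ 𝒫(n)} y^{B(m)}, a polynomial in y
Fcoeff : ℕ → ℕ → List ℕ
Fcoeff k n = foldr (λ m acc → addPℕ (monoℕ (B k m)) acc) [] (compositions n)

dFdy1 : ℕ → ℕ → ℕ
dFdy1 k n = evalAt1 (derivℕ (Fcoeff k n))

-- Integer polynomials in x (coefficient lists) and formal power series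
-- over ℤ (coefficient functions ℕ → ℤ).

addP : List ℤ → List ℤ → List ℤ
addP []       q        = q
addP (a ∷ p)  []       = a ∷ p
addP (a ∷ p)  (b ∷ q)  = (a ℤ.+ b) ∷ addP p q

scaleP : ℤ → List ℤ → List ℤ
scaleP c = map (c ℤ.*_)

mulP : List ℤ → List ℤ → List ℤ
mulP []       q = []
mulP (a ∷ p)  q = addP (scaleP a q) (+ 0 ∷ mulP p q)

xpow : ℕ → List ℤ
xpow zero    = + 1 ∷ []
xpow (suc j) = + 0 ∷ xpow j

Series : Set
Series = ℕ → ℤ

coeffP : List ℤ → Series
coeffP []      _       = + 0
coeffP (a ∷ p) zero    = a
coeffP (a ∷ p) (suc n) = coeffP p n

shiftS : Series → Series
shiftS f zero    = + 0
shiftS f (suc n) = f n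

mulPS : List ℤ → Series → Series
mulPS []      S n = + 0
mulPS (a ∷ p) S n = a ℤ.* S n ℤ.+ shiftS (mulPS p S) n

-- S = P / Q in ℤ[[x]] (Q has constant term 1, hence is invertible):
-- by definition, Q · S = P coefficientwise.
_≡_/ₚ_ : Series → List ℤ → List ℤ → Set
S ≡ P /ₚ Q = ∀ n → mulPS Q S n ≡ coeffP P n

δ : ℕ → ℕ
δ k = if isEvenᵇ k then 2 else 1

oneMinus2x oneMinusx onePlusx oneMinusx² : List ℤ
oneMinus2x = + 1 ∷ - (+ 2) ∷ []
oneMinusx  = + 1 ∷ - (+ 1) ∷ []
onePlusx   = + 1 ∷ + 1 ∷ []
oneMinusx² = + 1 ∷ + 0 ∷ - (+ 1) ∷ []

Tseries : ℕ → Series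
Tseries k n = + T k n

{-# OPTIONS --safe #-}
-- Splitting a composition of n + 1 after its first part j gives, with χ the indicator
-- of Ev_{>k} and C(r) = |𝒫(r)|,
--   T(n + 1) = Σ_{j=1}^{n+1} (χ(j) C(n + 1 − j) + T(n + 1 − j)).
-- As C = (1 − x)/(1 − 2x), this reads T = E + x T/(1 − x) with E = χ C, whence
-- (1 − 2x) T = (1 − x) E and (1 − 2x) E = (1 − x) χ.  Since k + δ is the least even
-- number above k, (1 − x²) χ = x^{k+δ}, and multiplying out gives both rational forms.
-- The derivative identity is linearity of ∂/∂y at y = 1 and ∂/∂y y^b |_{y=1} = b.

module Submission where

open import Defs
open import Data.Nat using (ℕ; _+_; _≤_)
open import Data.Integer using (+_)
open import Data.Product using (_×_)
open import Relation.Binary.PropositionalEquality using (_≡_)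

open import Data.Nat using (zero; suc; _*_; _∸_; _<_; z≤n; s≤s)
open import Data.Nat.Properties
  using (+-identityʳ; *-identityʳ; *-zeroʳ; +-suc; +-assoc; m∸n≤m; ≤-refl; ≤-trans)
open import Data.Nat.ListAction using (sum)
open import Data.Nat.ListAction.Properties using (sum-++)
import Data.Nat.Tactic.RingSolver as ℕ-Solver
open import Data.Integer as ℤ using (ℤ)
import Data.Integer.Properties as ℤ
import Data.Integer.Tactic.RingSolver as ℤ-Solver
open import Data.List using (List; []; _∷_; _++_; map; concatMap; upTo; applyUpTo; foldr)
open import Data.List.Properties using (map-++; map-cong; map-∘; map-upTo; concatMap-map; concatMap-cong; foldr-map)
open import Data.Bool using (true; false; if_then_else_)
open import Data.Product using (_,_)
open import Function using (_∘_)
open import Relation.Binary.PropositionalEquality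
  using (refl; sym; trans; cong; cong₂; _≗_; _→-setoid_; module ≡-Reasoning)
import Relation.Binary.Reasoning.Setoid as SetoidReasoning

private
  variable
    A B′ : Set

evalAt1-derivAux-addPℕ : ∀ i p q →
  evalAt1 (derivAux i (addPℕ p q)) ≡ evalAt1 (derivAux i p) + evalAt1 (derivAux i q)
evalAt1-derivAux-addPℕ i []      q       = refl
evalAt1-derivAux-addPℕ i (a ∷ p) []      = sym (+-identityʳ _)
evalAt1-derivAux-addPℕ i (a ∷ p) (b ∷ q) = begin
  i * (a + b) + evalAt1 (derivAux (suc i) (addPℕ p q))
    ≡⟨ cong (λ z → i * (a + b) + z) (evalAt1-derivAux-addPℕ (suc i) p q) ⟩
  i * (a + b) + (evalAt1 (derivAux (suc i) p) + evalAt1 (derivAux (suc i) q))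
    ≡⟨ regroup i a b _ _ ⟩
  (i * a + evalAt1 (derivAux (suc i) p)) + (i * b + evalAt1 (derivAux (suc i) q)) ∎
  where
  open ≡-Reasoning
  regroup : ∀ i a b x y → i * (a + b) + (x + y) ≡ (i * a + x) + (i * b + y)
  regroup = ℕ-Solver.solve-∀

evalAt1-derivℕ-addPℕ : ∀ p q →
  evalAt1 (derivℕ (addPℕ p q)) ≡ evalAt1 (derivℕ p) + evalAt1 (derivℕ q)
evalAt1-derivℕ-addPℕ []      q       = refl
evalAt1-derivℕ-addPℕ (a ∷ p) []      = sym (+-identityʳ _)
evalAt1-derivℕ-addPℕ (a ∷ p) (b ∷ q) = evalAt1-derivAux-addPℕ 1 p q

evalAt1-derivAux-monoℕ : ∀ i j → evalAt1 (derivAux i (monoℕ j)) ≡ i + j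
evalAt1-derivAux-monoℕ i zero    = cong (_+ 0) (*-identityʳ i)
evalAt1-derivAux-monoℕ i (suc j) =
  trans (cong₂ _+_ (*-zeroʳ i) (evalAt1-derivAux-monoℕ (suc i) j)) (sym (+-suc i j))

evalAt1-derivℕ-monoℕ : ∀ j → evalAt1 (derivℕ (monoℕ j)) ≡ j
evalAt1-derivℕ-monoℕ zero    = refl
evalAt1-derivℕ-monoℕ (suc j) = evalAt1-derivAux-monoℕ 1 j

evalAt1-derivℕ-sum-monoℕ : (f : A → ℕ) (xs : List A) →
  evalAt1 (derivℕ (foldr (λ x → addPℕ (monoℕ (f x))) [] xs)) ≡ foldr (λ x acc → f x + acc) 0 xs
evalAt1-derivℕ-sum-monoℕ f []       = refl
evalAt1-derivℕ-sum-monoℕ f (x ∷ xs) =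
  trans (evalAt1-derivℕ-addPℕ (monoℕ (f x)) _)
        (cong₂ _+_ (evalAt1-derivℕ-monoℕ (f x)) (evalAt1-derivℕ-sum-monoℕ f xs))

T≡dFdy1 : ∀ k n → T k n ≡ dFdy1 k n
T≡dFdy1 k n = sym (evalAt1-derivℕ-sum-monoℕ (B k) (compositions n))

compsF-suc : ∀ f n →
  compsF (suc f) (suc n) ≡ concatMap (λ i → map (suc i ∷_) (compsF f (n ∸ i))) (upTo (suc n))
compsF-suc f n = concatMap-map (λ j → map (j ∷_) (compsF f (suc n ∸ j))) suc (upTo (suc n))

compsF-fuel : ∀ {f g r} → r ≤ f → r ≤ g → compsF f r ≡ compsF g r
compsF-fuel {r = zero}                   _         _         = refl
compsF-fuel {suc f} {suc g} {suc n} (s≤s n≤f) (s≤s n≤g) = begin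
  compsF (suc f) (suc n)
    ≡⟨ compsF-suc f n ⟩
  concatMap (λ i → map (suc i ∷_) (compsF f (n ∸ i))) (upTo (suc n))
    ≡⟨ concatMap-cong (λ i → cong (map (suc i ∷_)) (compsF-fuel (below n≤f i) (below n≤g i))) (upTo (suc n)) ⟩
  concatMap (λ i → map (suc i ∷_) (compsF g (n ∸ i))) (upTo (suc n))
    ≡⟨ compsF-suc g n ⟨
  compsF (suc g) (suc n) ∎
  where
  open ≡-Reasoning
  below : ∀ {h} → n ≤ h → ∀ i → n ∸ i ≤ h
  below n≤h i = ≤-trans (m∸n≤m n i) n≤h

compositions-suc : ∀ n →
  compositions (suc n) ≡ concatMap (λ i → map (suc i ∷_) (compositions (n ∸ i))) (upTo (suc n))
compositions-suc n =
  trans (compsF-suc n n)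
        (concatMap-cong (λ i → cong (map (suc i ∷_)) (compsF-fuel (m∸n≤m n i) ≤-refl)) (upTo (suc n)))

sum-map-concatMap : (g : B′ → ℕ) (h : A → List B′) (xs : List A) →
  sum (map g (concatMap h xs)) ≡ sum (map (λ x → sum (map g (h x))) xs)
sum-map-concatMap g h []       = refl
sum-map-concatMap g h (x ∷ xs) = begin
  sum (map g (h x ++ concatMap h xs))
    ≡⟨ cong sum (map-++ g (h x) (concatMap h xs)) ⟩
  sum (map g (h x) ++ map g (concatMap h xs))
    ≡⟨ sum-++ (map g (h x)) _ ⟩
  sum (map g (h x)) + sum (map g (concatMap h xs))
    ≡⟨ cong (λ s → sum (map g (h x)) + s) (sum-map-concatMap g h xs) ⟩
  sum (map g (h x)) + sum (map (λ x → sum (map g (h x))) xs) ∎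
  where open ≡-Reasoning

Σ𝒫 : (List ℕ → ℕ) → ℕ → ℕ
Σ𝒫 g n = sum (map g (compositions n))

#compositions : ℕ → ℕ
#compositions = Σ𝒫 (λ _ → 1)

T≡Σ𝒫 : ∀ k n → T k n ≡ Σ𝒫 (B k) n
T≡Σ𝒫 k n = sym (foldr-map _+_ (B k) 0 (compositions n))

Σ𝒫-suc : ∀ g n →
  Σ𝒫 g (suc n) ≡ sum (applyUpTo (λ i → Σ𝒫 (g ∘ (suc i ∷_)) (n ∸ i)) (suc n))
Σ𝒫-suc g n = begin
  sum (map g (compositions (suc n)))
    ≡⟨ cong (sum ∘ map g) (compositions-suc n) ⟩
  sum (map g (concatMap (λ i → map (suc i ∷_) (compositions (n ∸ i))) (upTo (suc n))))
    ≡⟨ sum-map-concatMap g (λ i → map (suc i ∷_) (compositions (n ∸ i))) (upTo (suc n)) ⟩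
  sum (map (λ i → sum (map g (map (suc i ∷_) (compositions (n ∸ i))))) (upTo (suc n)))
    ≡⟨ cong sum (map-cong (λ i → cong sum (sym (map-∘ (compositions (n ∸ i))))) (upTo (suc n))) ⟩
  sum (map (λ i → Σ𝒫 (g ∘ (suc i ∷_)) (n ∸ i)) (upTo (suc n)))
    ≡⟨ cong sum (map-upTo _ (suc n)) ⟩
  sum (applyUpTo (λ i → Σ𝒫 (g ∘ (suc i ∷_)) (n ∸ i)) (suc n)) ∎
  where open ≡-Reasoning

prefixSum : (ℕ → ℕ) → ℕ → ℕ
prefixSum f n = sum (applyUpTo (λ i → f (n ∸ i)) (suc n))

convolve : (ℕ → ℕ) → (ℕ → ℕ) → ℕ → ℕ
convolve a b n = sum (applyUpTo (λ i → a i * b (n ∸ i)) (suc n))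

sum-applyUpTo-cong : ∀ {f g : ℕ → ℕ} → f ≗ g → ∀ n → sum (applyUpTo f n) ≡ sum (applyUpTo g n)
sum-applyUpTo-cong f≗g zero    = refl
sum-applyUpTo-cong f≗g (suc n) = cong₂ _+_ (f≗g 0) (sum-applyUpTo-cong (f≗g ∘ suc) n)

sum-applyUpTo-+ : ∀ (f g : ℕ → ℕ) n →
  sum (applyUpTo (λ i → f i + g i) n) ≡ sum (applyUpTo f n) + sum (applyUpTo g n)
sum-applyUpTo-+ f g zero    = refl
sum-applyUpTo-+ f g (suc n) =
  trans (cong (λ s → f 0 + g 0 + s) (sum-applyUpTo-+ (f ∘ suc) (g ∘ suc) n))
        (interchange (f 0) (g 0) _ _)
  where
  interchange : ∀ a b x y → a + b + (x + y) ≡ a + x + (b + y)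
  interchange = ℕ-Solver.solve-∀

sum-map-+-const : ∀ c (g : A → ℕ) xs →
  sum (map (λ x → c + g x) xs) ≡ c * sum (map (λ _ → 1) xs) + sum (map g xs)
sum-map-+-const c g []       = sym (cong (_+ 0) (*-zeroʳ c))
sum-map-+-const c g (x ∷ xs) =
  trans (cong (λ s → c + g x + s) (sum-map-+-const c g xs)) (regroup c (g x) _ _)
  where
  regroup : ∀ c y n s → c + y + (c * n + s) ≡ c * (1 + n) + (y + s)
  regroup = ℕ-Solver.solve-∀

-- (1 − 2x) a = (1 − x) b, coefficientwise and with the subtractions moved across.
record DoublingRecurrence (a b : ℕ → ℕ) : Set where
  constructor doubling
  field
    base : a 0 ≡ b 0
    step : ∀ n → a (suc n) + b n ≡ (a n + a n) + b (suc n)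

#compositions-suc : ∀ n → #compositions (suc n) ≡ prefixSum #compositions n
#compositions-suc = Σ𝒫-suc (λ _ → 1)

#compositions-double : ∀ n →
  #compositions (suc (suc n)) ≡ #compositions (suc n) + #compositions (suc n)
#compositions-double n =
  trans (#compositions-suc (suc n))
        (cong (λ c → #compositions (suc n) + c) (sym (#compositions-suc n)))

convolve-#compositions : ∀ ψ → DoublingRecurrence (convolve ψ #compositions) ψ
convolve-#compositions ψ = doubling (trans (+-identityʳ _) (*-identityʳ (ψ 0))) (step ψ)
  where
  C = #compositions
  step : ∀ ψ n → convolve ψ C (suc n) + ψ n ≡ (convolve ψ C n + convolve ψ C n) + ψ (suc n)
  step ψ zero    = regroup (ψ 0) (ψ 1)
    where
    regroup : ∀ a b → (a * 1 + (b * 1 + 0)) + a ≡ ((a * 1 + 0) + (a * 1 + 0)) + b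
    regroup = ℕ-Solver.solve-∀
  step ψ (suc n) = begin
    ψ 0 * C (suc (suc n)) + convolve (ψ ∘ suc) C (suc n) + ψ (suc n)
      ≡⟨ +-assoc (ψ 0 * C (suc (suc n))) _ _ ⟩
    ψ 0 * C (suc (suc n)) + (convolve (ψ ∘ suc) C (suc n) + ψ (suc n))
      ≡⟨ cong₂ _+_ (cong (ψ 0 *_) (#compositions-double n)) (step (ψ ∘ suc) n) ⟩
    ψ 0 * (C (suc n) + C (suc n)) + ((convolve (ψ ∘ suc) C n + convolve (ψ ∘ suc) C n) + ψ (suc (suc n)))
      ≡⟨ regroup (ψ 0) (C (suc n)) (convolve (ψ ∘ suc) C n) (ψ (suc (suc n))) ⟩
    ((ψ 0 * C (suc n) + convolve (ψ ∘ suc) C n) + (ψ 0 * C (suc n) + convolve (ψ ∘ suc) C n))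
      + ψ (suc (suc n)) ∎
    where
    open ≡-Reasoning
    regroup : ∀ a c x q → a * (c + c) + ((x + x) + q) ≡ ((a * c + x) + (a * c + x)) + q
    regroup = ℕ-Solver.solve-∀

-- t = e + x t / (1 − x)  implies  (1 − 2x) t = (1 − x) e.
prefixSum-recurrence : ∀ (t e : ℕ → ℕ) → t 0 ≡ e 0 →
  (∀ n → t (suc n) ≡ e (suc n) + prefixSum t n) → DoublingRecurrence t e
prefixSum-recurrence t e t₀≡e₀ t-suc = doubling t₀≡e₀ step
  where
  open ≡-Reasoning
  step : ∀ n → t (suc n) + e n ≡ (t n + t n) + e (suc n)
  step zero = begin
    t 1 + e 0              ≡⟨ cong₂ _+_ (t-suc 0) (sym t₀≡e₀) ⟩
    e 1 + (t 0 + 0) + t 0  ≡⟨ regroup (e 1) (t 0) ⟩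
    (t 0 + t 0) + e 1      ∎
    where
    regroup : ∀ e₁ t₀ → e₁ + (t₀ + 0) + t₀ ≡ (t₀ + t₀) + e₁
    regroup = ℕ-Solver.solve-∀
  step (suc n) = begin
    t (suc (suc n)) + e (suc n)
      ≡⟨ cong (_+ e (suc n)) (t-suc (suc n)) ⟩
    e (suc (suc n)) + (t (suc n) + prefixSum t n) + e (suc n)
      ≡⟨ regroup (e (suc (suc n))) (t (suc n)) (prefixSum t n) (e (suc n)) ⟩
    t (suc n) + (e (suc n) + prefixSum t n) + e (suc (suc n))
      ≡⟨ cong (λ s → t (suc n) + s + e (suc (suc n))) (sym (t-suc n)) ⟩
    (t (suc n) + t (suc n)) + e (suc (suc n)) ∎
    where
    regroup : ∀ e₂ t₁ s e₁ → e₂ + (t₁ + s) + e₁ ≡ t₁ + (e₁ + s) + e₂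
    regroup = ℕ-Solver.solve-∀

χEv : ℕ → ℕ → ℕ
χEv k j = if inEvGt k j then 1 else 0

B-∷ : ∀ k j m → B k (j ∷ m) ≡ χEv k j + B k m
B-∷ k j m with inEvGt k j
... | true  = refl
... | false = refl

Σ𝒫-B-∷ : ∀ k j r → Σ𝒫 (B k ∘ (j ∷_)) r ≡ χEv k j * #compositions r + Σ𝒫 (B k) r
Σ𝒫-B-∷ k j r =
  trans (cong sum (map-cong (B-∷ k j) (compositions r)))
        (sum-map-+-const (χEv k j) (B k) (compositions r))

-- The i = 0 term of the convolution vanishes since 0 ∉ Ev_{>k}.
T-suc : ∀ k n → T k (suc n) ≡ convolve (χEv k) #compositions (suc n) + prefixSum (T k) n
T-suc k n = begin
  T k (suc n)
    ≡⟨ T≡Σ𝒫 k (suc n) ⟩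
  Σ𝒫 (B k) (suc n)
    ≡⟨ Σ𝒫-suc (B k) n ⟩
  sum (applyUpTo (λ i → Σ𝒫 (B k ∘ (suc i ∷_)) (n ∸ i)) (suc n))
    ≡⟨ sum-applyUpTo-cong first-part (suc n) ⟩
  sum (applyUpTo (λ i → χEv k (suc i) * #compositions (n ∸ i) + T k (n ∸ i)) (suc n))
    ≡⟨ sum-applyUpTo-+ (λ i → χEv k (suc i) * #compositions (n ∸ i)) (λ i → T k (n ∸ i)) (suc n) ⟩
  convolve (χEv k) #compositions (suc n) + prefixSum (T k) n ∎
  where
  open ≡-Reasoning
  first-part : ∀ i → Σ𝒫 (B k ∘ (suc i ∷_)) (n ∸ i) ≡ χEv k (suc i) * #compositions (n ∸ i) + T k (n ∸ i)
  first-part i = trans (Σ𝒫-B-∷ k (suc i) (n ∸ i))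
                       (cong (λ s → χEv k (suc i) * #compositions (n ∸ i) + s) (sym (T≡Σ𝒫 k (n ∸ i))))

T-doublingRecurrence : ∀ k → DoublingRecurrence (T k) (convolve (χEv k) #compositions)
T-doublingRecurrence k = prefixSum-recurrence (T k) _ refl (T-suc k)

infixl 6 _+ₛ_
infixl 7 _*ₛ_

_+ₛ_ : Series → Series → Series
(S +ₛ S′) n = S n ℤ.+ S′ n

_*ₛ_ : ℤ → Series → Series
(c *ₛ S) n = c ℤ.* S n

module ≗-Reasoning = SetoidReasoning (ℕ →-setoid ℤ)

shiftS-cong : ∀ {S S′} → S ≗ S′ → shiftS S ≗ shiftS S′
shiftS-cong S≗S′ zero    = refl
shiftS-cong S≗S′ (suc n) = S≗S′ n

shiftS-+ₛ : ∀ S S′ → shiftS (S +ₛ S′) ≗ shiftS S +ₛ shiftS S′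
shiftS-+ₛ S S′ zero    = refl
shiftS-+ₛ S S′ (suc n) = refl

shiftS-*ₛ : ∀ c S → shiftS (c *ₛ S) ≗ c *ₛ shiftS S
shiftS-*ₛ c S zero    = sym (ℤ.*-zeroʳ c)
shiftS-*ₛ c S (suc n) = refl

mulPS-cong : ∀ p {S S′} → S ≗ S′ → mulPS p S ≗ mulPS p S′
mulPS-cong []      S≗S′ n = refl
mulPS-cong (a ∷ p) S≗S′ n = cong₂ ℤ._+_ (cong (a ℤ.*_) (S≗S′ n)) (shiftS-cong (mulPS-cong p S≗S′) n)

mulPS-+ₛ : ∀ p S S′ → mulPS p (S +ₛ S′) ≗ mulPS p S +ₛ mulPS p S′
mulPS-+ₛ []      S S′ n = refl
mulPS-+ₛ (a ∷ p) S S′ n = begin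
  a ℤ.* (S n ℤ.+ S′ n) ℤ.+ shiftS (mulPS p (S +ₛ S′)) n
    ≡⟨ cong (λ z → a ℤ.* (S n ℤ.+ S′ n) ℤ.+ z)
            (trans (shiftS-cong (mulPS-+ₛ p S S′) n) (shiftS-+ₛ (mulPS p S) (mulPS p S′) n)) ⟩
  a ℤ.* (S n ℤ.+ S′ n) ℤ.+ (shiftS (mulPS p S) n ℤ.+ shiftS (mulPS p S′) n)
    ≡⟨ regroup a (S n) (S′ n) _ _ ⟩
  (a ℤ.* S n ℤ.+ shiftS (mulPS p S) n) ℤ.+ (a ℤ.* S′ n ℤ.+ shiftS (mulPS p S′) n) ∎
  where
  open ≡-Reasoning
  regroup : ∀ a x y u v → a ℤ.* (x ℤ.+ y) ℤ.+ (u ℤ.+ v) ≡ (a ℤ.* x ℤ.+ u) ℤ.+ (a ℤ.* y ℤ.+ v)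
  regroup = ℤ-Solver.solve-∀

mulPS-*ₛ : ∀ p c S → mulPS p (c *ₛ S) ≗ c *ₛ mulPS p S
mulPS-*ₛ []      c S n = sym (ℤ.*-zeroʳ c)
mulPS-*ₛ (a ∷ p) c S n =
  trans (cong (λ z → a ℤ.* (c ℤ.* S n) ℤ.+ z)
              (trans (shiftS-cong (mulPS-*ₛ p c S) n) (shiftS-*ₛ c (mulPS p S) n)))
        (regroup a c (S n) _)
  where
  regroup : ∀ a c x u → a ℤ.* (c ℤ.* x) ℤ.+ c ℤ.* u ≡ c ℤ.* (a ℤ.* x ℤ.+ u)
  regroup = ℤ-Solver.solve-∀

mulPS-zero : ∀ p → mulPS p (λ _ → + 0) ≗ (λ _ → + 0)
mulPS-zero p n = trans (mulPS-*ₛ p (+ 0) (λ _ → + 0) n) (ℤ.*-zeroˡ (mulPS p (λ _ → + 0) n))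

mulPS-shiftS : ∀ p S → mulPS p (shiftS S) ≗ shiftS (mulPS p S)
mulPS-shiftS []      S zero    = refl
mulPS-shiftS []      S (suc n) = refl
mulPS-shiftS (a ∷ p) S zero    = trans (ℤ.+-identityʳ _) (ℤ.*-zeroʳ a)
mulPS-shiftS (a ∷ p) S (suc n) = cong (λ z → a ℤ.* S n ℤ.+ z) (mulPS-shiftS p S n)

mulPS-comm : ∀ p q S → mulPS p (mulPS q S) ≗ mulPS q (mulPS p S)
mulPS-comm []      q S n = sym (mulPS-zero q n)
mulPS-comm (a ∷ p) q S n = begin
  a ℤ.* mulPS q S n ℤ.+ shiftS (mulPS p (mulPS q S)) n
    ≡⟨ cong (λ z → a ℤ.* mulPS q S n ℤ.+ z) (shiftS-cong (mulPS-comm p q S) n) ⟩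
  a ℤ.* mulPS q S n ℤ.+ shiftS (mulPS q (mulPS p S)) n
    ≡⟨ cong₂ ℤ._+_ (mulPS-*ₛ q a S n) (mulPS-shiftS q (mulPS p S) n) ⟨
  mulPS q (a *ₛ S) n ℤ.+ mulPS q (shiftS (mulPS p S)) n
    ≡⟨ mulPS-+ₛ q (a *ₛ S) (shiftS (mulPS p S)) n ⟨
  mulPS q (mulPS (a ∷ p) S) n ∎
  where open ≡-Reasoning

mulPS-addP : ∀ p q S → mulPS (addP p q) S ≗ mulPS p S +ₛ mulPS q S
mulPS-addP []      q       S n = sym (ℤ.+-identityˡ _)
mulPS-addP (a ∷ p) []      S n = sym (ℤ.+-identityʳ _)
mulPS-addP (a ∷ p) (b ∷ q) S n =
  trans (cong (λ z → (a ℤ.+ b) ℤ.* S n ℤ.+ z)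
              (trans (shiftS-cong (mulPS-addP p q S) n) (shiftS-+ₛ (mulPS p S) (mulPS q S) n)))
        (regroup a b (S n) _ _)
  where
  regroup : ∀ a b x u v → (a ℤ.+ b) ℤ.* x ℤ.+ (u ℤ.+ v) ≡ (a ℤ.* x ℤ.+ u) ℤ.+ (b ℤ.* x ℤ.+ v)
  regroup = ℤ-Solver.solve-∀

mulPS-scaleP : ∀ c q S → mulPS (scaleP c q) S ≗ c *ₛ mulPS q S
mulPS-scaleP c []      S n = sym (ℤ.*-zeroʳ c)
mulPS-scaleP c (b ∷ q) S n =
  trans (cong (λ z → (c ℤ.* b) ℤ.* S n ℤ.+ z)
              (trans (shiftS-cong (mulPS-scaleP c q S) n) (shiftS-*ₛ c (mulPS q S) n)))
        (regroup c b (S n) _)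
  where
  regroup : ∀ c b x u → (c ℤ.* b) ℤ.* x ℤ.+ c ℤ.* u ≡ c ℤ.* (b ℤ.* x ℤ.+ u)
  regroup = ℤ-Solver.solve-∀

mulPS-mulP : ∀ p q S → mulPS (mulP p q) S ≗ mulPS p (mulPS q S)
mulPS-mulP []      q S n = refl
mulPS-mulP (a ∷ p) q S n = begin
  mulPS (addP (scaleP a q) (+ 0 ∷ mulP p q)) S n
    ≡⟨ mulPS-addP (scaleP a q) (+ 0 ∷ mulP p q) S n ⟩
  mulPS (scaleP a q) S n ℤ.+ (+ 0 ℤ.* S n ℤ.+ shiftS (mulPS (mulP p q) S) n)
    ≡⟨ cong₂ ℤ._+_ (mulPS-scaleP a q S n)
                   (trans (cong (ℤ._+ shiftS (mulPS (mulP p q) S) n) (ℤ.*-zeroˡ (S n)))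
                          (ℤ.+-identityˡ _)) ⟩
  a ℤ.* mulPS q S n ℤ.+ shiftS (mulPS (mulP p q) S) n
    ≡⟨ cong (λ z → a ℤ.* mulPS q S n ℤ.+ z) (shiftS-cong (mulPS-mulP p q S) n) ⟩
  a ℤ.* mulPS q S n ℤ.+ shiftS (mulPS p (mulPS q S)) n ∎
  where open ≡-Reasoning

coeffP≗mulPS-one : ∀ p → coeffP p ≗ mulPS p (coeffP (+ 1 ∷ []))
coeffP≗mulPS-one []      n       = refl
coeffP≗mulPS-one (a ∷ p) zero    = sym (trans (ℤ.+-identityʳ _) (ℤ.*-identityʳ a))
coeffP≗mulPS-one (a ∷ p) (suc n) =
  trans (coeffP≗mulPS-one p n)
        (sym (trans (cong (ℤ._+ mulPS p _ n) (ℤ.*-zeroʳ a)) (ℤ.+-identityˡ _)))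

mulPS-coeffP : ∀ p q → mulPS p (coeffP q) ≗ coeffP (mulP q p)
mulPS-coeffP p q = begin
  mulPS p (coeffP q)            ≈⟨ mulPS-cong p (coeffP≗mulPS-one q) ⟩
  mulPS p (mulPS q one)         ≈⟨ mulPS-comm p q one ⟩
  mulPS q (mulPS p one)         ≈⟨ mulPS-mulP q p one ⟨
  mulPS (mulP q p) one          ≈⟨ coeffP≗mulPS-one (mulP q p) ⟨
  coeffP (mulP q p)             ∎
  where
  open ≗-Reasoning
  one = coeffP (+ 1 ∷ [])

cross-multiply : ∀ Q S Q′ S′ P R →
  mulPS Q S ≗ mulPS Q′ S′ → S′ ≡ P /ₚ R → S ≡ mulP P Q′ /ₚ mulP Q R
cross-multiply Q S Q′ S′ P R QS≗Q′S′ S′≡P/R = begin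
  mulPS (mulP Q R) S     ≈⟨ mulPS-mulP Q R S ⟩
  mulPS Q (mulPS R S)    ≈⟨ mulPS-comm Q R S ⟩
  mulPS R (mulPS Q S)    ≈⟨ mulPS-cong R QS≗Q′S′ ⟩
  mulPS R (mulPS Q′ S′)  ≈⟨ mulPS-comm R Q′ S′ ⟩
  mulPS Q′ (mulPS R S′)  ≈⟨ mulPS-cong Q′ S′≡P/R ⟩
  mulPS Q′ (coeffP P)    ≈⟨ mulPS-coeffP Q′ P ⟩
  coeffP (mulP P Q′)     ∎
  where open ≗-Reasoning

mulPS-linear-suc : ∀ a b S m → mulPS (a ∷ b ∷ []) S (suc m) ≡ a ℤ.* S (suc m) ℤ.+ b ℤ.* S m
mulPS-linear-suc a b S zero    = cong (λ z → a ℤ.* S 1 ℤ.+ z) (ℤ.+-identityʳ (b ℤ.* S 0))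
mulPS-linear-suc a b S (suc m) =
  cong (λ z → a ℤ.* S (suc (suc m)) ℤ.+ z) (ℤ.+-identityʳ (b ℤ.* S (suc m)))

doublingRecurrence⇒mulPS : ∀ {a b} → DoublingRecurrence a b →
  mulPS oneMinus2x (+_ ∘ a) ≗ mulPS oneMinusx (+_ ∘ b)
doublingRecurrence⇒mulPS (doubling a₀≡b₀ _) zero = cong (λ z → + 1 ℤ.* + z ℤ.+ + 0) a₀≡b₀
doublingRecurrence⇒mulPS {a} {b} (doubling _ rec) (suc m) = begin
  mulPS oneMinus2x (+_ ∘ a) (suc m)
    ≡⟨ mulPS-linear-suc (+ 1) (ℤ.- + 2) (+_ ∘ a) m ⟩
  + 1 ℤ.* + a (suc m) ℤ.+ ℤ.- + 2 ℤ.* + a m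
    ≡⟨ regroupˡ (+ a (suc m)) (+ a m) (+ b m) ⟩
  (+ a (suc m) ℤ.+ + b m) ℤ.- (+ a m ℤ.+ + a m) ℤ.- + b m
    ≡⟨ cong (λ z → + z ℤ.- (+ a m ℤ.+ + a m) ℤ.- + b m) (rec m) ⟩
  (+ a m ℤ.+ + a m ℤ.+ + b (suc m)) ℤ.- (+ a m ℤ.+ + a m) ℤ.- + b m
    ≡⟨ regroupʳ (+ a m ℤ.+ + a m) (+ b (suc m)) (+ b m) ⟩
  + 1 ℤ.* + b (suc m) ℤ.+ ℤ.- + 1 ℤ.* + b m
    ≡⟨ mulPS-linear-suc (+ 1) (ℤ.- + 1) (+_ ∘ b) m ⟨
  mulPS oneMinusx (+_ ∘ b) (suc m) ∎
  where
  open ≡-Reasoning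
  regroupˡ : ∀ a₁ a₀ b₀ → + 1 ℤ.* a₁ ℤ.+ ℤ.- + 2 ℤ.* a₀ ≡ (a₁ ℤ.+ b₀) ℤ.- (a₀ ℤ.+ a₀) ℤ.- b₀
  regroupˡ = ℤ-Solver.solve-∀
  regroupʳ : ∀ d b₁ b₀ → d ℤ.+ b₁ ℤ.- d ℤ.- b₀ ≡ + 1 ℤ.* b₁ ℤ.+ ℤ.- + 1 ℤ.* b₀
  regroupʳ = ℤ-Solver.solve-∀

coeffP-xpow-< : ∀ {K n} → n < K → coeffP (xpow K) n ≡ + 0
coeffP-xpow-< {suc K} {zero}  _         = refl
coeffP-xpow-< {suc K} {suc n} (s≤s n<K) = coeffP-xpow-< n<K

2≤k+δk : ∀ k → 2 ≤ k + δ k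
2≤k+δk zero          = ≤-refl
2≤k+δk (suc zero)    = ≤-refl
2≤k+δk (suc (suc k)) = s≤s (s≤s z≤n)

-- Both sides are invariant under (k, m) ↦ (k + 2, m + 2).
χEv-suc-suc : ∀ k m → + χEv k (suc (suc m)) ≡ + χEv k m ℤ.+ coeffP (xpow (k + δ k)) (suc (suc m))
χEv-suc-suc zero          zero          = refl
χEv-suc-suc zero          (suc zero)    = refl
χEv-suc-suc zero          (suc (suc m)) = sym (ℤ.+-identityʳ _)
χEv-suc-suc (suc zero)    zero          = refl
χEv-suc-suc (suc zero)    (suc zero)    = refl
χEv-suc-suc (suc zero)    (suc (suc m)) = sym (ℤ.+-identityʳ _)
χEv-suc-suc (suc (suc k)) zero          =
  sym (cong (λ z → + 0 ℤ.+ z) (coeffP-xpow-< (≤-trans (s≤s z≤n) (2≤k+δk k))))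
χEv-suc-suc (suc (suc k)) (suc zero)    = sym (cong (λ z → + 0 ℤ.+ z) (coeffP-xpow-< (2≤k+δk k)))
χEv-suc-suc (suc (suc k)) (suc (suc m)) = χEv-suc-suc k m

χEv≡xpow/oneMinusx² : ∀ k → (+_ ∘ χEv k) ≡ xpow (k + δ k) /ₚ oneMinusx²
χEv≡xpow/oneMinusx² k zero          = sym (coeffP-xpow-< (≤-trans (s≤s z≤n) (2≤k+δk k)))
χEv≡xpow/oneMinusx² k (suc zero)    = sym (coeffP-xpow-< (2≤k+δk k))
χEv≡xpow/oneMinusx² k (suc (suc m)) = begin
  + 1 ℤ.* χ (suc (suc m)) ℤ.+ mulPS (+ 0 ∷ ℤ.- + 1 ∷ []) χ (suc m)
    ≡⟨ cong (λ z → + 1 ℤ.* χ (suc (suc m)) ℤ.+ z) (mulPS-linear-suc (+ 0) (ℤ.- + 1) χ m) ⟩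
  + 1 ℤ.* χ (suc (suc m)) ℤ.+ (+ 0 ℤ.* χ (suc m) ℤ.+ ℤ.- + 1 ℤ.* χ m)
    ≡⟨ cong (λ z → + 1 ℤ.* z ℤ.+ (+ 0 ℤ.* χ (suc m) ℤ.+ ℤ.- + 1 ℤ.* χ m)) (χEv-suc-suc k m) ⟩
  + 1 ℤ.* (χ m ℤ.+ c) ℤ.+ (+ 0 ℤ.* χ (suc m) ℤ.+ ℤ.- + 1 ℤ.* χ m)
    ≡⟨ cancel (χ m) c (χ (suc m)) ⟩
  c ∎
  where
  open ≡-Reasoning
  χ = +_ ∘ χEv k
  c = coeffP (xpow (k + δ k)) (suc (suc m))
  cancel : ∀ x c y → + 1 ℤ.* (x ℤ.+ c) ℤ.+ (+ 0 ℤ.* y ℤ.+ ℤ.- + 1 ℤ.* x) ≡ c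
  cancel = ℤ-Solver.solve-∀

onePlusx*oneMinusx : mulP onePlusx oneMinusx ≡ oneMinusx²
onePlusx*oneMinusx = refl

module _ (k : ℕ) where
  private
    Φ = +_ ∘ χEv k
    E = +_ ∘ convolve (χEv k) #compositions

  oneMinus2x²-Tseries :
    mulPS (mulP oneMinus2x oneMinus2x) (Tseries k) ≗ mulPS oneMinusx (mulPS oneMinusx Φ)
  oneMinus2x²-Tseries = begin
    mulPS (mulP oneMinus2x oneMinus2x) (Tseries k)
      ≈⟨ mulPS-mulP oneMinus2x oneMinus2x (Tseries k) ⟩
    mulPS oneMinus2x (mulPS oneMinus2x (Tseries k))
      ≈⟨ mulPS-cong oneMinus2x (doublingRecurrence⇒mulPS (T-doublingRecurrence k)) ⟩
    mulPS oneMinus2x (mulPS oneMinusx E)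
      ≈⟨ mulPS-comm oneMinus2x oneMinusx E ⟩
    mulPS oneMinusx (mulPS oneMinus2x E)
      ≈⟨ mulPS-cong oneMinusx (doublingRecurrence⇒mulPS (convolve-#compositions (χEv k))) ⟩
    mulPS oneMinusx (mulPS oneMinusx Φ) ∎
    where open ≗-Reasoning

  oneMinusx-χEv≡xpow/onePlusx : mulPS oneMinusx Φ ≡ xpow (k + δ k) /ₚ onePlusx
  oneMinusx-χEv≡xpow/onePlusx = begin
    mulPS onePlusx (mulPS oneMinusx Φ)   ≈⟨ mulPS-mulP onePlusx oneMinusx Φ ⟨
    mulPS (mulP onePlusx oneMinusx) Φ    ≡⟨ cong (λ p → mulPS p Φ) onePlusx*oneMinusx ⟩
    mulPS oneMinusx² Φ                   ≈⟨ χEv≡xpow/oneMinusx² k ⟩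
    coeffP (xpow (k + δ k))              ∎
    where open ≗-Reasoning

proposition4p7 : (k : ℕ) → 1 ≤ k →
  ((n : ℕ) → T k n ≡ dFdy1 k n)
  × (Tseries k ≡ mulP (xpow (k + δ k)) (mulP oneMinusx oneMinusx)
                 /ₚ mulP (mulP oneMinus2x oneMinus2x) oneMinusx²)
  × (Tseries k ≡ mulP (xpow (k + δ k)) oneMinusx
                 /ₚ mulP (mulP oneMinus2x oneMinus2x) onePlusx)
proposition4p7 k _ =
    T≡dFdy1 k
  , cross-multiply A² (Tseries k) (mulP oneMinusx oneMinusx) Φ (xpow (k + δ k)) oneMinusx²
      (λ n → trans (oneMinus2x²-Tseries k n) (sym (mulPS-mulP oneMinusx oneMinusx Φ n)))
      (χEv≡xpow/oneMinusx² k)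
  , cross-multiply A² (Tseries k) oneMinusx (mulPS oneMinusx Φ) (xpow (k + δ k)) onePlusx
      (oneMinus2x²-Tseries k)
      (oneMinusx-χEv≡xpow/onePlusx k)
  where
  A² = mulP oneMinus2x oneMinus2x
  Φ  = +_ ∘ χEv k
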